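{- Let $w$ be a word of length $N$ over an alphabet $\mathcal{A}_k$ with $k$ letters. Then for all integers $n$ with $1\le n<K_w$, \[p_w(n+1)-p_w(n)\le k\bigl(p_w(n)-p_w(n-1)\bigr).\]
   Context: A subword (factor) of $w=w_1\cdots w_N$ is a contiguous block $w_iw_{i+1}\cdots w_j$, and the empty word is the unique subword of length $0$. For $\ell\ge 0$, $p_w(\ell)$ is the number of distinct subwords of $w$ of length $\ell$ (so $p_w(0)=1$). $K_w$ denotes the minimal length of a suffix of $w$ that occurs exactly once in $w$ (as a subword). -}

module Defs where

open import Data.Nat using (ℕ; zero; suc; _+_; _∸_; _≤_; _<_)
open import Data.Fin using (Fin)
open import Data.Fin.Properties using () renaming (_≟_ to _≟ᶠ_)
open import Data.List using (List; length; take; drop; map; upTo; filter; deduplicate; reverse)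
open import Data.List.Properties using (≡-dec)
open import Relation.Binary.PropositionalEquality using (_≡_)
open import Relation.Nullary.Decidable using (Dec)

Word : ℕ → Set
Word k = List (Fin k)

_≟w_ : ∀ {k} (u v : Word k) → Dec (u ≡ v)
_≟w_ = ≡-dec _≟ᶠ_

factorAt : ∀ {k} → Word k → ℕ → ℕ → Word k
factorAt w i ℓ = take ℓ (drop i w)

-- The list of all factors of length ℓ, one per starting position
-- i = 0 .. N - ℓ (with N = length w); empty if ℓ > N.
-- (For ℓ = 0 this lists the empty word N+1 times.)
factorsOfLength : ∀ {k} → Word k → ℕ → List (Word k)
factorsOfLength w ℓ with ℓ Data.Nat.≤? length w
... | Relation.Nullary.Decidable.yes _ = map (λ i → factorAt w i ℓ) (upTo (suc (length w ∸ ℓ)))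
... | Relation.Nullary.Decidable.no  _ = Data.List.[]

p : ∀ {k} → Word k → ℕ → ℕ
p w ℓ = length (deduplicate _≟w_ (factorsOfLength w ℓ))

occurrences : ∀ {k} → Word k → Word k → ℕ
occurrences w u = length (filter (λ v → v ≟w u) (factorsOfLength w (length u)))

suffix : ∀ {k} → Word k → ℕ → Word k
suffix w ℓ = drop (length w ∸ ℓ) w

IsK : ∀ {k} → Word k → ℕ → Set
IsK w K = (K ≤ length w)
  Data.Product.× (occurrences w (suffix w K) ≡ 1)
  Data.Product.× (∀ m → m < K → Relation.Nullary.¬ (occurrences w (suffix w m) ≡ 1))
  where import Data.Product; import Relation.Nullary

module Submission where

-- For a set L of words over Fin k write c(m) for the
-- number of words of length m in L and ext(u) for the number of letters b
-- with u ++ [ b ] ∈ L.  When L is closed under taking prefixes and suffixes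
-- (a factorial language), every word a ∷ v of length m + 1 satisfies the
-- exchange inequality
--     ext (a ∷ v) + [v ∈ L]  ≤  ext v + [a ∷ v ∈ L],
-- provided v ∈ L has at least one right extension in L.  Summing it over all
-- words a ∷ v of length m + 1 gives c(m+2) + k c(m) ≤ k c(m+1) + c(m+1),
-- the additive form of c(m+2) - c(m+1) ≤ k (c(m+1) - c(m)).
--
-- Afterwards the factors
-- of w are shown to form a factorial language counted by p w, and a factor v
-- with |v| < K_w is shown to extend to the right: either v is followed by a
-- letter, or v is the suffix of w, which by minimality of K_w occurs a second
-- time earlier in w.

open import Defs
open import Data.Nat using (ℕ; _≤_; _<_; _∸_; _+_)
open import Data.Integer using (ℤ; +_; _-_; _*_) renaming (_≤_ to _≤ℤ_)

open import Data.Nat using (zero; suc; z≤n; s≤s; _≤?_; _⊓_) renaming (_*_ to _·_)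
import Data.Nat.Properties as ℕP
import Data.Integer as ℤ
import Data.Integer.Properties as ℤP
open import Data.Integer.Tactic.RingSolver using (solve-∀)
open import Data.Fin using (Fin) renaming (zero to fzero; suc to fsuc)
import Data.Fin.Properties as FinP
open import Data.List using (List; []; _∷_; _++_; [_]; length; take; drop; map; upTo; filter; deduplicate)
open import Data.List.Properties using (++-assoc; ++-identityʳ; length-++; length-++-≤ˡ; length-take; length-drop; take++drop≡id; take-all; upTo-∷ʳ; map-++; filter-++; filter-none; filter-accept; ∷-injectiveˡ; ∷-injectiveʳ)
open import Data.List.Relation.Unary.All as All using (All; []; _∷_)
open import Data.List.Relation.Unary.All.Properties using (¬Any⇒All¬)
open import Data.List.Relation.Unary.Any using (Any; here; there; any?)
import Data.List.Relation.Unary.Any.Properties as AnyP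
open import Data.List.Relation.Unary.AllPairs using ([]; _∷_)
open import Data.List.Relation.Unary.Unique.Propositional using (Unique)
open import Data.List.Relation.Unary.Unique.DecPropositional.Properties using (deduplicate-!)
open import Data.List.Membership.Propositional using (_∈_; _∉_; find)
open import Data.List.Membership.Propositional.Properties using (∈-map⁺; ∈-map⁻; ∈-upTo⁺; ∈-upTo⁻; ∈-deduplicate⁺; ∈-deduplicate⁻)
open import Data.Product using (∃; ∃₂; _×_; _,_; proj₁; proj₂)
open import Data.Empty using (⊥-elim)
open import Relation.Nullary using (¬_; Dec; yes; no)
open import Relation.Nullary.Decidable using (decidable-stable; map′)
open import Relation.Binary.PropositionalEquality using (_≡_; _≢_; refl; sym; trans; cong; cong₂; subst; subst₂; module ≡-Reasoning)
open import Function using (_∘_)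
open import Level using (Level)
open import Algebra.Properties.Semiring.Sum ℕP.+-*-semiring using (sum; sum-cong-≗; ∑-distrib-+; sum-replicate-zero)

private
  variable
    ℓ ℓ′ : Level
    P : Set ℓ
    Q : Set ℓ′

𝟙 : Dec P → ℕ
𝟙 (yes _) = 1
𝟙 (no _)  = 0

𝟙-yes : (d : Dec P) → P → 𝟙 d ≡ 1
𝟙-yes (yes _) _  = refl
𝟙-yes (no ¬p) p = ⊥-elim (¬p p)

𝟙-no : (d : Dec P) → ¬ P → 𝟙 d ≡ 0
𝟙-no (yes p) ¬p = ⊥-elim (¬p p)
𝟙-no (no _)  _  = refl

𝟙-≤1 : (d : Dec P) → 𝟙 d ≤ 1
𝟙-≤1 (yes _) = s≤s z≤n
𝟙-≤1 (no _)  = z≤n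

𝟙-mono : (P → Q) → (d : Dec P) (e : Dec Q) → 𝟙 d ≤ 𝟙 e
𝟙-mono P⇒Q (yes p) e = ℕP.≤-reflexive (sym (𝟙-yes e (P⇒Q p)))
𝟙-mono P⇒Q (no _)  e = z≤n

𝟙-cong : (P → Q) → (Q → P) → (d : Dec P) (e : Dec Q) → 𝟙 d ≡ 𝟙 e
𝟙-cong P⇒Q Q⇒P d e = ℕP.≤-antisym (𝟙-mono P⇒Q d e) (𝟙-mono Q⇒P e d)

sum-mono : ∀ {n} {f g : Fin n → ℕ} → (∀ i → f i ≤ g i) → sum f ≤ sum g
sum-mono {zero}  f≤g = z≤n
sum-mono {suc n} f≤g = ℕP.+-mono-≤ (f≤g fzero) (sum-mono (f≤g ∘ fsuc))

sum-const : ∀ {n} (c : ℕ) → sum {n} (λ _ → c) ≡ n · c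
sum-const {zero}  c = refl
sum-const {suc n} c = cong (_+_ c) (sum-const {n} c)

≤-sum : ∀ {n} (f : Fin n → ℕ) (i : Fin n) → f i ≤ sum f
≤-sum {suc n} f fzero    = ℕP.m≤m+n (f fzero) _
≤-sum {suc n} f (fsuc i) = ℕP.≤-trans (≤-sum (f ∘ fsuc) i) (ℕP.m≤n+m _ (f fzero))

sum-vanish : ∀ {n} {f : Fin n → ℕ} → (∀ i → f i ≡ 0) → sum f ≡ 0
sum-vanish {n} f≡0 = trans (sum-cong-≗ f≡0) (sum-replicate-zero n)

sum-single : ∀ {n} (f : Fin n → ℕ) (a : Fin n) → (∀ i → i ≢ a → f i ≡ 0) → sum f ≡ f a
sum-single {suc n} f fzero    off = trans (cong (_+_ (f fzero)) (sum-vanish (λ i → off (fsuc i) λ ()))) (ℕP.+-identityʳ _)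
sum-single {suc n} f (fsuc a) off =
  cong₂ _+_ (off fzero λ ()) (sum-single (f ∘ fsuc) a (λ i i≢a → off (fsuc i) (i≢a ∘ FinP.suc-injective)))

module _ {k : ℕ} where

  open import Data.List.Membership.DecPropositional (_≟w_ {k}) using (_∈?_)

  ∑ʷ : ℕ → (Word k → ℕ) → ℕ
  ∑ʷ zero    g = g []
  ∑ʷ (suc m) g = sum (λ a → ∑ʷ m (λ v → g (a ∷ v)))

  ∑ʷ-cong : ∀ m {g h : Word k → ℕ} → (∀ u → length u ≡ m → g u ≡ h u) → ∑ʷ m g ≡ ∑ʷ m h
  ∑ʷ-cong zero    g≡h = g≡h [] refl
  ∑ʷ-cong (suc m) g≡h = sum-cong-≗ (λ a → ∑ʷ-cong m (λ v |v| → g≡h (a ∷ v) (cong suc |v|)))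

  ∑ʷ-mono : ∀ m {g h : Word k → ℕ} → (∀ u → length u ≡ m → g u ≤ h u) → ∑ʷ m g ≤ ∑ʷ m h
  ∑ʷ-mono zero    g≤h = g≤h [] refl
  ∑ʷ-mono (suc m) g≤h = sum-mono (λ a → ∑ʷ-mono m (λ v |v| → g≤h (a ∷ v) (cong suc |v|)))

  ∑ʷ-+ : ∀ m (g h : Word k → ℕ) → ∑ʷ m (λ u → g u + h u) ≡ ∑ʷ m g + ∑ʷ m h
  ∑ʷ-+ zero    g h = refl
  ∑ʷ-+ (suc m) g h = trans (sum-cong-≗ (λ a → ∑ʷ-+ m (g ∘ (a ∷_)) (h ∘ (a ∷_))))
                           (∑-distrib-+ (λ a → ∑ʷ m (g ∘ (a ∷_))) (λ a → ∑ʷ m (h ∘ (a ∷_))))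

  ∑ʷ-vanish : ∀ m {g : Word k → ℕ} → (∀ u → length u ≡ m → g u ≡ 0) → ∑ʷ m g ≡ 0
  ∑ʷ-vanish zero    g≡0 = g≡0 [] refl
  ∑ʷ-vanish (suc m) g≡0 = sum-vanish (λ a → ∑ʷ-vanish m (λ v |v| → g≡0 (a ∷ v) (cong suc |v|)))

  ∑ʷ-tail : ∀ m (g : Word k → ℕ) → ∑ʷ (suc m) (g ∘ drop 1) ≡ k · ∑ʷ m g
  ∑ʷ-tail m g = sum-const {k} (∑ʷ m g)

  ∑ʷ-snoc : ∀ m (g : Word k → ℕ) → ∑ʷ (suc m) g ≡ ∑ʷ m (λ u → sum (λ b → g (u ++ [ b ])))
  ∑ʷ-snoc zero    g = refl
  ∑ʷ-snoc (suc m) g = sum-cong-≗ (λ a → ∑ʷ-snoc m (g ∘ (a ∷_)))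

  ∑ʷ-single : ∀ m (g : Word k → ℕ) y → length y ≡ m →
              (∀ u → length u ≡ m → u ≢ y → g u ≡ 0) → ∑ʷ m g ≡ g y
  ∑ʷ-single zero    g []      refl off = refl
  ∑ʷ-single (suc m) g (a ∷ y) |ay| off = trans
    (sum-single _ a (λ b b≢a → ∑ʷ-vanish m (λ v |v| → off (b ∷ v) (cong suc |v|) (b≢a ∘ ∷-injectiveˡ))))
    (∑ʷ-single m (g ∘ (a ∷_)) y (ℕP.suc-injective |ay|) (λ v |v| v≢y → off (a ∷ v) (cong suc |v|) (v≢y ∘ ∷-injectiveʳ)))

  𝟙-∈-∷ : ∀ {y ys} → y ∉ ys → ∀ u → 𝟙 (u ∈? (y ∷ ys)) ≡ 𝟙 (u ≟w y) + 𝟙 (u ∈? ys)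
  𝟙-∈-∷ {y} {ys} y∉ys u = split (u ≟w y)
    where
    split : (d : Dec (u ≡ y)) → 𝟙 (u ∈? (y ∷ ys)) ≡ 𝟙 d + 𝟙 (u ∈? ys)
    split (yes refl) = trans (𝟙-yes (u ∈? _) (here refl)) (cong suc (sym (𝟙-no (u ∈? ys) y∉ys)))
    split (no u≢y)   = 𝟙-cong (λ { (here u≡y) → ⊥-elim (u≢y u≡y) ; (there u∈ys) → u∈ys }) there _ _

  count-unique : ∀ m {ys : List (Word k)} → Unique ys → All (λ u → length u ≡ m) ys →
                 length ys ≡ ∑ʷ m (λ u → 𝟙 (u ∈? ys))
  count-unique m {[]} [] [] = sym (∑ʷ-vanish m (λ u _ → 𝟙-no (u ∈? []) λ ()))
  count-unique m {y ∷ ys} (y≢ys ∷ unique) (|y| ∷ lengths) = begin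
    suc (length ys)                                        ≡⟨ cong suc (count-unique m unique lengths) ⟩
    1 + ∑ʷ m (λ u → 𝟙 (u ∈? ys))                           ≡⟨ cong (_+ ∑ʷ m (λ u → 𝟙 (u ∈? ys))) (sym is-y) ⟩
    ∑ʷ m (λ u → 𝟙 (u ≟w y)) + ∑ʷ m (λ u → 𝟙 (u ∈? ys))     ≡⟨ sym (∑ʷ-+ m _ _) ⟩
    ∑ʷ m (λ u → 𝟙 (u ≟w y) + 𝟙 (u ∈? ys))                   ≡⟨ ∑ʷ-cong m (λ u _ → sym (𝟙-∈-∷ y∉ys u)) ⟩
    ∑ʷ m (λ u → 𝟙 (u ∈? (y ∷ ys)))                          ∎
    where
    open ≡-Reasoning
    y∉ys : y ∉ ys
    y∉ys y∈ys = All.lookup y≢ys y∈ys refl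
    is-y : ∑ʷ m (λ u → 𝟙 (u ≟w y)) ≡ 1
    is-y = trans (∑ʷ-single m _ y |y| (λ u _ u≢y → 𝟙-no (u ≟w y) u≢y)) (𝟙-yes (y ≟w y) refl)

module FactorialLanguage {k ℓ} (L : Word k → Set ℓ) (L? : ∀ u → Dec (L u))
  (prefix-closed : ∀ u b → L (u ++ [ b ]) → L u)
  (suffix-closed : ∀ a u → L (a ∷ u) → L u) where

  count : ℕ → ℕ
  count m = ∑ʷ m (λ u → 𝟙 (L? u))

  extensions : Word k → ℕ
  extensions u = sum (λ b → 𝟙 (L? (u ++ [ b ])))

  count-suc : ∀ m → count (suc m) ≡ ∑ʷ m extensions
  count-suc m = ∑ʷ-snoc m (λ u → 𝟙 (L? u))

  RightExtendable : ℕ → Set ℓ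
  RightExtendable m = ∀ v → length v ≡ m → L v → ∃ λ b → L (v ++ [ b ])

  𝟙≤extensions : ∀ v → (L v → ∃ λ b → L (v ++ [ b ])) → 𝟙 (L? v) ≤ extensions v
  𝟙≤extensions v extend with L? v
  ... | no _    = z≤n
  ... | yes v∈L = let (b , vb∈L) = extend v∈L in
    subst (_≤ extensions v) (𝟙-yes (L? (v ++ [ b ])) vb∈L) (≤-sum (λ b → 𝟙 (L? (v ++ [ b ]))) b)

  -- The exchange inequality: if a ∷ v ∈ L, its extensions are extensions
  -- of v; otherwise a ∷ v has no extensions and v is paid for by one of its own.
  exchange : ∀ a v → (L v → ∃ λ b → L (v ++ [ b ])) →
             extensions (a ∷ v) + 𝟙 (L? v) ≤ extensions v + 𝟙 (L? (a ∷ v))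
  exchange a v extend with L? (a ∷ v)
  ... | yes av∈L = ℕP.+-mono-≤ (sum-mono {k} (λ b → 𝟙-mono (suffix-closed a _) _ _)) (𝟙-≤1 (L? v))
  ... | no av∉L  = begin
    extensions (a ∷ v) + 𝟙 (L? v) ≡⟨ cong (_+ 𝟙 (L? v)) no-extensions ⟩
    𝟙 (L? v)                      ≤⟨ 𝟙≤extensions v extend ⟩
    extensions v                  ≡⟨ ℕP.+-identityʳ _ ⟨
    extensions v + 0              ∎
    where
    open ℕP.≤-Reasoning
    no-extensions : extensions (a ∷ v) ≡ 0
    no-extensions = sum-vanish (λ b → 𝟙-no (L? (a ∷ v ++ [ b ])) (av∉L ∘ prefix-closed (a ∷ v) b))

  -- Summing the exchange inequality over all words a ∷ v of length m + 1:
  -- c(m+2) + k c(m) ≤ k c(m+1) + c(m+1).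
  growth : ∀ m → RightExtendable m → count (2 + m) + k · count m ≤ k · count (1 + m) + count (1 + m)
  growth m extendable = begin
    count (2 + m) + k · count m
      ≡⟨ cong₂ _+_ (count-suc (suc m)) (sym (∑ʷ-tail m (λ u → 𝟙 (L? u)))) ⟩
    ∑ʷ (1 + m) extensions + ∑ʷ (1 + m) (λ u → 𝟙 (L? (drop 1 u)))
      ≡⟨ ∑ʷ-+ (1 + m) extensions (λ u → 𝟙 (L? (drop 1 u))) ⟨
    ∑ʷ (1 + m) (λ u → extensions u + 𝟙 (L? (drop 1 u)))
      ≤⟨ ∑ʷ-mono (1 + m) exchange-at ⟩
    ∑ʷ (1 + m) (λ u → extensions (drop 1 u) + 𝟙 (L? u))
      ≡⟨ ∑ʷ-+ (1 + m) (extensions ∘ drop 1) (λ u → 𝟙 (L? u)) ⟩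
    ∑ʷ (1 + m) (extensions ∘ drop 1) + count (1 + m)
      ≡⟨ cong (_+ count (1 + m)) (trans (∑ʷ-tail m extensions) (cong (k ·_) (sym (count-suc m)))) ⟩
    k · count (1 + m) + count (1 + m) ∎
    where
    open ℕP.≤-Reasoning
    exchange-at : ∀ u → length u ≡ 1 + m → extensions u + 𝟙 (L? (drop 1 u)) ≤ extensions (drop 1 u) + 𝟙 (L? u)
    exchange-at (a ∷ v) |av| = exchange a v (extendable v (ℕP.suc-injective |av|))

module _ {a} {A : Set a} where

  drop-length-++ : (xs ys : List A) → drop (length xs) (xs ++ ys) ≡ ys
  drop-length-++ []       ys = refl
  drop-length-++ (x ∷ xs) ys = drop-length-++ xs ys

  take-length-++ : (xs ys : List A) → take (length xs) (xs ++ ys) ≡ xs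
  take-length-++ []       ys = refl
  take-length-++ (x ∷ xs) ys = cong (x ∷_) (take-length-++ xs ys)

module Factors {k : ℕ} (w : Word k) where

  open import Data.List.Membership.DecPropositional (_≟w_ {k}) using (_∈?_)

  N : ℕ
  N = length w

  Occurs : Word k → Set
  Occurs u = ∃₂ λ pre suf → pre ++ u ++ suf ≡ w

  occurs-prefix : ∀ u b → Occurs (u ++ [ b ]) → Occurs u
  occurs-prefix u b (pre , suf , eq) = pre , b ∷ suf , trans (cong (pre ++_) (sym (++-assoc u [ b ] suf))) eq

  occurs-suffix : ∀ a u → Occurs (a ∷ u) → Occurs u
  occurs-suffix a u (pre , suf , eq) = pre ++ [ a ] , suf , trans (++-assoc pre [ a ] (u ++ suf)) eq

  window-decomposition : ∀ i m → take i w ++ factorAt w i m ++ drop m (drop i w) ≡ w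
  window-decomposition i m = trans (cong (take i w ++_) (take++drop≡id m (drop i w))) (take++drop≡id i w)

  length-factorAt : ∀ i m → i + m ≤ N → length (factorAt w i m) ≡ m
  length-factorAt i m i+m≤N = begin
    length (take m (drop i w)) ≡⟨ length-take m (drop i w) ⟩
    m ⊓ length (drop i w)      ≡⟨ cong (m ⊓_) (length-drop i w) ⟩
    m ⊓ (N ∸ i)                ≡⟨ ℕP.m≤n⇒m⊓n≡m (ℕP.m+n≤o⇒m≤o∸n m (subst (_≤ N) (ℕP.+-comm i m) i+m≤N)) ⟩
    m                          ∎
    where open ≡-Reasoning

  factorAt-occurrence : ∀ {u} pre suf → pre ++ u ++ suf ≡ w → factorAt w (length pre) (length u) ≡ u
  factorAt-occurrence {u} pre suf eq = begin
    take (length u) (drop (length pre) w)                  ≡⟨ cong (take (length u) ∘ drop (length pre)) eq ⟨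
    take (length u) (drop (length pre) (pre ++ u ++ suf))  ≡⟨ cong (take (length u)) (drop-length-++ pre (u ++ suf)) ⟩
    take (length u) (u ++ suf)                             ≡⟨ take-length-++ u suf ⟩
    u                                                      ∎
    where open ≡-Reasoning

  occurrence-bound : ∀ {u} pre suf → pre ++ u ++ suf ≡ w → length pre + length u ≤ N
  occurrence-bound {u} pre suf eq =
    subst₂ _≤_ (length-++ pre) (cong length (trans (++-assoc pre u suf) eq)) (length-++-≤ˡ (pre ++ u))

  factorsOfLength-≤ : ∀ {m} → m ≤ N → factorsOfLength w m ≡ map (λ i → factorAt w i m) (upTo (suc (N ∸ m)))
  factorsOfLength-≤ {m} m≤N with m ≤? N
  ... | yes _   = refl
  ... | no m≰N = ⊥-elim (m≰N m≤N)

  ∈-factors⇒ : ∀ {m u} → u ∈ factorsOfLength w m → Occurs u × length u ≡ m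
  ∈-factors⇒ {m} {u} u∈ with m ≤? N
  ... | no _ with () ← u∈
  ... | yes m≤N with i , i∈ , refl ← ∈-map⁻ (λ i → factorAt w i m) u∈ =
    (take i w , drop m (drop i w) , window-decomposition i m) ,
    length-factorAt i m (ℕP.m≤o∸n⇒m+n≤o i m≤N (ℕP.≤-pred (∈-upTo⁻ i∈)))

  Occurs⇒∈-factors : ∀ {u} → Occurs u → u ∈ factorsOfLength w (length u)
  Occurs⇒∈-factors {u} (pre , suf , eq) with length u ≤? N
  ... | no |u|≰N = ⊥-elim (|u|≰N (ℕP.≤-trans (ℕP.m≤n+m (length u) (length pre)) (occurrence-bound pre suf eq)))
  ... | yes _    = subst (_∈ _) (factorAt-occurrence pre suf eq)
    (∈-map⁺ (λ i → factorAt w i (length u)) (∈-upTo⁺ (s≤s (ℕP.m+n≤o⇒m≤o∸n (length pre) (occurrence-bound pre suf eq)))))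

  occurs? : ∀ u → Dec (Occurs u)
  occurs? u = map′ (proj₁ ∘ ∈-factors⇒ {length u}) Occurs⇒∈-factors (u ∈? factorsOfLength w (length u))

  p-as-count : ∀ m → p w m ≡ ∑ʷ m (λ u → 𝟙 (occurs? u))
  p-as-count m = trans
    (count-unique m (deduplicate-! _≟w_ factors) (All.tabulate (proj₂ ∘ ∈-factors⇒ ∘ from-dedup)))
    (∑ʷ-cong m (λ u |u| → 𝟙-cong (proj₁ ∘ ∈-factors⇒ {m} ∘ from-dedup)
                                   (∈-deduplicate⁺ _≟w_ ∘ subst (λ l → u ∈ factorsOfLength w l) |u| ∘ Occurs⇒∈-factors)
                                   _ _))
    where
    factors : List (Word k)
    factors = factorsOfLength w m
    from-dedup : ∀ {u} → u ∈ deduplicate _≟w_ factors → u ∈ factors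
    from-dedup = ∈-deduplicate⁻ _≟w_ factors

  extend : ∀ {v} pre suf → pre ++ v ++ suf ≡ w → 0 < length suf → ∃ λ b → Occurs (v ++ [ b ])
  extend {v} pre (b ∷ suf) eq _ = b , pre , suf , trans (cong (pre ++_) (++-assoc v [ b ] suf)) eq

  suffix-occurrence : ∀ {v} pre → pre ++ v ≡ w → suffix w (length v) ≡ v
  suffix-occurrence {v} pre eq = begin
    drop (N ∸ length v) w                         ≡⟨ cong (λ z → drop (length z ∸ length v) z) eq ⟨
    drop (length (pre ++ v) ∸ length v) (pre ++ v) ≡⟨ cong (λ t → drop t (pre ++ v)) |pre| ⟩
    drop (length pre) (pre ++ v)                   ≡⟨ drop-length-++ pre v ⟩
    v                                              ∎
    where
    open ≡-Reasoning
    |pre| : length (pre ++ v) ∸ length v ≡ length pre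
    |pre| = trans (cong (_∸ length v) (length-++ pre)) (ℕP.m+n∸n≡m (length pre) (length v))

  -- The windows of length m ≤ N start at 0, …, N ∸ m and the last one is the
  -- suffix s; so s occurs once more than among the windows starting before N ∸ m.
  occurrences-suffix : ∀ m → m ≤ N →
    occurrences w (suffix w m) ≡ length (filter (_≟w suffix w m) (map (λ i → factorAt w i m) (upTo (N ∸ m)))) + 1
  occurrences-suffix m m≤N = begin
    length (filter P? (factorsOfLength w (length s)))          ≡⟨ cong (λ l → length (filter P? (factorsOfLength w l))) |s| ⟩
    length (filter P? (factorsOfLength w m))                   ≡⟨ cong (length ∘ filter P?) (factorsOfLength-≤ m≤N) ⟩
    length (filter P? (map window (upTo (suc M))))             ≡⟨ cong (length ∘ filter P? ∘ map window) (upTo-∷ʳ M) ⟨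
    length (filter P? (map window (upTo M ++ [ M ])))          ≡⟨ cong (length ∘ filter P?) (map-++ window (upTo M) [ M ]) ⟩
    length (filter P? (map window (upTo M) ++ [ window M ]))   ≡⟨ cong length (filter-++ P? (map window (upTo M)) [ window M ]) ⟩
    length (filter P? (map window (upTo M)) ++ filter P? [ window M ])
      ≡⟨ cong (λ l → length (filter P? (map window (upTo M)) ++ l)) (filter-accept P? last-window) ⟩
    length (filter P? (map window (upTo M)) ++ [ window M ])   ≡⟨ length-++ (filter P? (map window (upTo M))) ⟩
    length (filter P? (map window (upTo M))) + 1               ∎
    where
    open ≡-Reasoning
    s = suffix w m
    M = N ∸ m
    P? = _≟w s
    window : ℕ → Word k
    window i = factorAt w i m
    |s| : length s ≡ m
    |s| = trans (length-drop M w) (ℕP.m∸[m∸n]≡n m≤N)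
    last-window : window M ≡ s
    last-window = take-all m s (ℕP.≤-reflexive |s|)

  extend-window : ∀ j m → m ≤ N → j < N ∸ m → ∃ λ b → Occurs (factorAt w j m ++ [ b ])
  extend-window j m m≤N j<N∸m = extend (take j w) (drop m (drop j w)) (window-decomposition j m) rest-nonempty
    where
    |rest| : length (drop m (drop j w)) ≡ N ∸ (j + m)
    |rest| = trans (length-drop m (drop j w)) (trans (cong (_∸ m) (length-drop j w)) (ℕP.∸-+-assoc N j m))
    rest-nonempty : 0 < length (drop m (drop j w))
    rest-nonempty = subst (0 <_) (sym |rest|) (ℕP.m<n⇒0<n∸m (ℕP.m≤o∸n⇒m+n≤o (suc j) m≤N j<N∸m))

  -- Minimality of K_w: the suffix of length m < K_w also occurs at some
  -- position j < N ∸ m, i.e. not only as the last window.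
  earlier-occurrence : ∀ {K} → IsK w K → ∀ m → m < K → ∃ λ j → j < N ∸ m × factorAt w j m ≡ suffix w m
  earlier-occurrence (K≤N , _ , minimal) m m<K =
    let j , j∈ , window≡s = find (AnyP.map⁻ (decidable-stable (any? P? windows) not-unique))
    in j , ∈-upTo⁻ j∈ , window≡s
    where
    s = suffix w m
    P? = _≟w s
    windows : List (Word k)
    windows = map (λ i → factorAt w i m) (upTo (N ∸ m))
    not-unique : ¬ ¬ Any (_≡ s) windows
    not-unique none = minimal m m<K (trans (occurrences-suffix m (ℕP.≤-trans (ℕP.<⇒≤ m<K) K≤N))
                                           (cong (λ l → length l + 1) (filter-none P? (¬Any⇒All¬ windows none))))

  -- For |v| < K_w every factor v of w extends to a factor v ++ [ b ]: either
  -- the given occurrence of v is followed by a letter, or v is the suffix of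
  -- w and its earlier occurrence is.
  right-extension : ∀ {K} → IsK w K → ∀ v → length v < K → Occurs v → ∃ λ b → Occurs (v ++ [ b ])
  right-extension _ v _ (pre , suf@(_ ∷ _) , eq) = extend pre suf eq (s≤s z≤n)
  right-extension isK v |v|<K (pre , [] , eq) =
    let j , j<N∸m , window≡s = earlier-occurrence isK (length v) |v|<K
    in subst (λ u → ∃ λ b → Occurs (u ++ [ b ])) (trans window≡s v-is-suffix)
             (extend-window j (length v) (ℕP.≤-trans (ℕP.<⇒≤ |v|<K) (proj₁ isK)) j<N∸m)
    where
    v-is-suffix : suffix w (length v) ≡ v
    v-is-suffix = suffix-occurrence pre (trans (cong (pre ++_) (sym (++-identityʳ v))) eq)

  p-growth : ∀ {K} → IsK w K → ∀ m → m < K → p w (2 + m) + k · p w m ≤ k · p w (1 + m) + p w (1 + m)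
  p-growth isK m m<K rewrite p-as-count (2 + m) | p-as-count (1 + m) | p-as-count m =
    growth m (λ v |v| → right-extension isK v (subst (_< _) (sym |v|) m<K))
    where open FactorialLanguage Occurs occurs? occurs-prefix occurs-suffix

difference-form : ∀ a b c k → a + k · c ≤ k · b + b → + a - + b ≤ℤ + k * (+ b - + c)
difference-form a b c k a+kc≤kb+b = begin
  + a - + b                                   ≡⟨ shift (+ a) (+ b) (+ k * + c) ⟩
  (+ a ℤ.+ + k * + c) - (+ b ℤ.+ + k * + c)   ≡⟨ cong₂ _-_ (cast a c) (cast b c) ⟨
  + (a + k · c) - + (b + k · c)               ≤⟨ ℤP.+-monoˡ-≤ (ℤ.- + (b + k · c)) (ℤ.+≤+ a+kc≤kb+b) ⟩
  + (k · b + b) - + (b + k · c)               ≡⟨ cong₂ _-_ (ℤP.pos-+ (k · b) b) (cast b c) ⟩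
  (+ (k · b) ℤ.+ + b) - (+ b ℤ.+ + k * + c)   ≡⟨ cong (λ x → (x ℤ.+ + b) - (+ b ℤ.+ + k * + c)) (ℤP.pos-* k b) ⟩
  (+ k * + b ℤ.+ + b) - (+ b ℤ.+ + k * + c)   ≡⟨ factor (+ b) (+ c) (+ k) ⟨
  + k * (+ b - + c)                           ∎
  where
  open ℤP.≤-Reasoning
  cast : ∀ x y → + (x + k · y) ≡ + x ℤ.+ + k * + y
  cast x y = trans (ℤP.pos-+ x (k · y)) (cong (ℤ._+_ (+ x)) (ℤP.pos-* k y))
  shift : ∀ (A B D : ℤ) → A - B ≡ (A ℤ.+ D) - (B ℤ.+ D)
  shift = solve-∀
  factor : ∀ (B C K : ℤ) → K * (B - C) ≡ (K * B ℤ.+ B) - (B ℤ.+ K * C)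
  factor = solve-∀

theorem3p6 : (k : ℕ) (w : Word k) (K : ℕ) → IsK w K →
    (n : ℕ) → 1 ≤ n → n < K →
    (+ p w (n + 1)) - (+ p w n) ≤ℤ (+ k) * ((+ p w n) - (+ p w (n ∸ 1)))
theorem3p6 k w K isK (suc m) _ 1+m<K =
  subst (λ n → + p w n - + p w (suc m) ≤ℤ + k * (+ p w (suc m) - + p w m)) (cong suc (ℕP.+-comm 1 m))
    (difference-form (p w (2 + m)) (p w (1 + m)) (p w m) k (p-growth isK m (ℕP.<⇒≤ 1+m<K)))
  where open Factors w
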